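{- Let $g,d$ be positive integers, $\preceq$ a relaxed monomial order on $\mathbb{N}^d$ and $T\in\operatorname{R}_\preceq(\mathcal{S}_{g-1,d})$. Let $\mathbf{n}$ be a minimal generator of $T$ such that $\mathbf{n}\preceq\sigma(\mathbf{n})$ for all $\sigma\in\operatorname{P}_d$. Then $T\setminus\{\mathbf{n}\}\in\operatorname{R}_\preceq(\mathcal{S}_{g,d})$.
   Context: A generalized numerical semigroup (GNS) in $\mathbb{N}^d$ is a submonoid $S$ of $(\mathbb{N}^d,+)$ with $\operatorname{H}(S)=\mathbb{N}^d\setminus S$ finite; $|\operatorname{H}(S)|$ is its genus; $\mathcal{S}_{g,d}$ is the set of GNSs in $\mathbb{N}^d$ of genus $g$ ($\mathcal{S}_{0,d}=\{\mathbb{N}^d\}$). Minimal generators of $S$ are the elements of $S^*\setminus(S^*+S^*)$, $S^*=S\setminus\{\mathbf{0}\}$. $\operatorname{P}_d$ is the set of permutations of $\{1,\ldots,d\}$, acting by $\sigma(\sum x_i\mathbf{e}_i)=\sum x_i\mathbf{e}_{\sigma(i)}$ ($\mathbf{e}_i$ standard basis) and elementwise on sets; $[S]_\simeq=\{\sigma(S)\mid\sigma\in\operatorname{P}_d\}$. A relaxed monomial order is a total order $\preceq$ on $\mathbb{N}^d$ with $\mathbf{0}\preceq\mathbf{v}$ for all $\mathbf{v}$ and such that $\mathbf{v}\prec\mathbf{w}$ implies $\mathbf{v}\prec\mathbf{w}+\mathbf{u}$ for all $\mathbf{u}$. For $S,S'\in\mathcal{S}_{g,d}$ with gaps $\mathbf{h}_1\prec\cdots\prec\mathbf{h}_g$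 and $\mathbf{h}'_1\prec\cdots\prec\mathbf{h}'_g$, $S\preceq_{\operatorname{R}}S'$ means $S=S'$ or $\mathbf{h}_r\prec\mathbf{h}'_r$ for $r=\min\{i\mid\mathbf{h}_i\neq\mathbf{h}'_i\}$; $\operatorname{R}_\preceq(S)=\min_{\preceq_{\operatorname{R}}}[S]_\simeq$ and $\operatorname{R}_\preceq(\mathcal{S}_{g,d})=\{\operatorname{R}_\preceq(S)\mid S\in\mathcal{S}_{g,d}\}$. -}

module Defs where

open import Data.Nat using (ℕ; _+_)
open import Data.Fin using (Fin)
open import Data.Fin.Permutation using (Permutation′; _⟨$⟩ˡ_)
open import Data.Vec using (Vec; replicate; zipWith; tabulate; lookup)
open import Data.List using (List; length; _++_; _∷_)
open import Data.List.Membership.Propositional using (_∈_)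
open import Data.List.Relation.Unary.Unique.Propositional using (Unique)
open import Data.List.Relation.Unary.Linked using (Linked)
open import Data.Product using (Σ; ∃; ∃-syntax; _×_)
open import Data.Sum using (_⊎_)
open import Relation.Nullary using (¬_)
open import Relation.Binary.PropositionalEquality using (_≡_; _≢_)
open import Relation.Binary.Structures using (IsTotalOrder)
open import Function.Bundles using (_⇔_)

ℕ^ : ℕ → Set
ℕ^ d = Vec ℕ d

𝟎 : ∀ {d} → ℕ^ d
𝟎 {d} = replicate d 0

_⊕_ : ∀ {d} → ℕ^ d → ℕ^ d → ℕ^ d
_⊕_ = zipWith _+_

Subset : ℕ → Set₁
Subset d = ℕ^ d → Set

_≐_ : ∀ {d} → Subset d → Subset d → Set
S ≐ S' = ∀ x → S x ⇔ S' x

_∖[_] : ∀ {d} → Subset d → ℕ^ d → Subset d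
(S ∖[ n ]) x = S x × x ≢ n

record IsGNS {d : ℕ} (g : ℕ) (S : Subset d) : Set where
  field
    zero∈ : S 𝟎
    closed : ∀ x y → S x → S y → S (x ⊕ y)
    gaps : List (ℕ^ d)
    gaps-unique : Unique gaps
    gaps-spec : ∀ x → (x ∈ gaps) ⇔ (¬ S x)
    genus : length gaps ≡ g

IsMinimalGenerator : ∀ {d} → Subset d → ℕ^ d → Set
IsMinimalGenerator S n =
  S n × n ≢ 𝟎 ×
  ¬ (∃[ a ] ∃[ b ] (S a × a ≢ 𝟎 × S b × b ≢ 𝟎 × n ≡ a ⊕ b))

-- Permutations of {1..d} acting on ℕ^d:  σ(Σ xᵢ eᵢ) = Σ xᵢ e_{σ(i)},
-- i.e. the j-th coordinate of σ(x) is x_{σ⁻¹(j)}.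
act : ∀ {d} → Permutation′ d → ℕ^ d → ℕ^ d
act σ x = tabulate (λ j → lookup x (σ ⟨$⟩ˡ j))

actSet : ∀ {d} → Permutation′ d → Subset d → Subset d
actSet σ S y = ∃[ x ] (S x × y ≡ act σ x)

record IsRelaxedMonomialOrder {d : ℕ} (_≼_ : ℕ^ d → ℕ^ d → Set) : Set where
  field
    isTotalOrder : IsTotalOrder _≡_ _≼_
    zero-least : ∀ v → 𝟎 ≼ v
    compat : ∀ v w u → v ≼ w → v ≢ w → (v ≼ (w ⊕ u)) × (v ≢ (w ⊕ u))

module _ {d : ℕ} (_≼_ : ℕ^ d → ℕ^ d → Set) where

  _≺_ : ℕ^ d → ℕ^ d → Set
  v ≺ w = (v ≼ w) × (v ≢ w)

  SortedGaps : Subset d → List (ℕ^ d) → Set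
  SortedGaps S L = Linked _≺_ L × (∀ x → (x ∈ L) ⇔ (¬ S x))

  _≼R_ : Subset d → Subset d → Set
  S ≼R S' = (S ≐ S') ⊎
    (∃[ L ] ∃[ L' ] (SortedGaps S L × SortedGaps S' L' ×
      ∃[ p ] ∃[ h ] ∃[ h' ] ∃[ t ] ∃[ t' ]
        (L ≡ p ++ (h ∷ t) × L' ≡ p ++ (h' ∷ t') × h ≺ h')))

  IsRepresentative : Subset d → Subset d → Set
  IsRepresentative S T =
    (∃[ σ ] (T ≐ actSet σ S)) × (∀ σ → T ≼R actSet σ S)

  InR : ℕ → Subset d → Set₁
  InR g T = ∃[ S ] (IsGNS g S × IsRepresentative S T)

{-# OPTIONS --safe #-}
-- Write T = σ(S) with S a GNS of genus g − 1. Then n = σ(y) for a minimal generator y of S, so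
-- S ∖ {y} is a GNS of genus g and T ∖ {n} = σ(S ∖ {y}). For every τ, τ(S ∖ {y}) = τ(S) ∖ {τ(y)},
-- and the sorted gap lists of T ∖ {n} and τ(S) ∖ {τ(y)} arise by inserting n, resp. τ(y), into
-- those of T and τ(S). As T ≼_R τ(S) and n ≼ τ(y) (n is least in its orbit), the insertions keep
-- the lexicographic comparison: if n lands before the first difference, then either n = τ(y) lands
-- at the same place, or n is below the entry opposite it; otherwise the first difference survives.
module Submission where

open import Defs
open import Data.Nat using (ℕ; _≤_; _∸_)
open import Data.Fin.Permutation using (Permutation′)

open import Level using (0ℓ)
open import Data.Nat using (suc; _+_; _≟_)
open import Data.Nat.Properties using (+-identityˡ; +-identityʳ)
open import Data.Fin.Permutation using (_⟨$⟩ˡ_; inverseˡ; inverseʳ; flip; _∘ₚ_)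
open import Data.Vec using (Vec; lookup; tabulate)
open import Data.Vec.Properties
  using (lookup∘tabulate; tabulate∘lookup; tabulate-cong; lookup-zipWith; lookup-replicate;
         zipWith-identityˡ; zipWith-identityʳ; ≡-dec)
open import Data.List using (List; []; _∷_; _++_; map; foldr)
open import Data.List.Membership.Propositional using (_∈_; _∉_)
open import Data.List.Membership.Propositional.Properties using (∈-map⁺; ∈-map⁻)
open import Data.List.Relation.Unary.Any using (here; there; toSum; fromSum)
open import Data.List.Relation.Unary.AllPairs using (_∷_)
open import Data.List.Relation.Unary.All.Properties.Core using (¬Any⇒All¬)
open import Data.List.Relation.Unary.Linked using (Linked; []; [-]; _∷_)
open import Data.Product using (∃-syntax; _×_; _,_; proj₁; proj₂; map₁)
open import Data.Sum using (_⊎_; inj₁; inj₂; [_,_])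
import Data.Sum as Sum
open import Data.Empty using (⊥-elim)
open import Function using (_∘_; id)
open import Relation.Nullary using (¬_; yes; no)
open import Relation.Binary.Core using (Rel)
open import Relation.Binary.Definitions using (DecidableEquality; Trichotomous; Transitive; tri<; tri≈; tri>)
open import Relation.Binary.Structures using (IsTotalOrder)
import Relation.Binary.Construct.NonStrictToStrict as NonStrictToStrict
open import Relation.Binary.PropositionalEquality
  using (_≡_; _≢_; _≗_; refl; sym; trans; cong; cong₂; subst; module ≡-Reasoning)
open import Function.Bundles using (_⇔_; mk⇔; Equivalence)
open import Function.Properties.Equivalence using () renaming (sym to ⇔-sym; trans to ⇔-trans)
open Equivalence using (to; from)

module StrictInsertion {A : Set} {_≤_ : Rel A 0ℓ}
  (_≟ₐ_ : DecidableEquality A) (isTotalOrder : IsTotalOrder _≡_ _≤_) where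

  open IsTotalOrder isTotalOrder using (isPartialOrder; antisym; total) renaming (trans to ≤-trans)
  open NonStrictToStrict _≡_ _≤_ using (_<_; <-trichotomous)

  <-trans : Transitive _<_
  <-trans = NonStrictToStrict.<-trans _≡_ _≤_ isPartialOrder

  <-≤-trans : ∀ {x y z} → x < y → y ≤ z → x < z
  <-≤-trans = NonStrictToStrict.<-≤-trans _≡_ _≤_ sym ≤-trans antisym λ { refl x≤y → x≤y }

  compare : Trichotomous _≡_ _<_
  compare = <-trichotomous sym _≟ₐ_ antisym total

  insert : A → List A → List A
  insert x [] = x ∷ []
  insert x (y ∷ ys) with compare x y
  ... | tri< _ _ _ = x ∷ y ∷ ys
  ... | tri≈ _ _ _ = y ∷ ys
  ... | tri> _ _ _ = y ∷ insert x ys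

  ∈-insert⁻ : ∀ {x z} xs → z ∈ insert x xs → z ≡ x ⊎ z ∈ xs
  ∈-insert⁻ [] (here z≡x) = inj₁ z≡x
  ∈-insert⁻ {x} (y ∷ ys) z∈ with compare x y
  ... | tri< _ _ _ = toSum z∈
  ... | tri≈ _ _ _ = inj₂ z∈
  ... | tri> _ _ _ with z∈
  ...   | here z≡y = inj₂ (here z≡y)
  ...   | there z∈ys = Sum.map₂ there (∈-insert⁻ ys z∈ys)

  ∈-insert⁺ : ∀ {x z} xs → z ≡ x ⊎ z ∈ xs → z ∈ insert x xs
  ∈-insert⁺ [] (inj₁ z≡x) = here z≡x
  ∈-insert⁺ {x} (y ∷ ys) z∈ with compare x y
  ... | tri< _ _ _ = fromSum z∈
  ... | tri≈ _ x≡y _ = [ (λ z≡x → here (trans z≡x x≡y)) , id ] z∈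
  ... | tri> _ _ _ with z∈
  ...   | inj₁ z≡x = there (∈-insert⁺ ys (inj₁ z≡x))
  ...   | inj₂ (here z≡y) = here z≡y
  ...   | inj₂ (there z∈ys) = there (∈-insert⁺ ys (inj₂ z∈ys))

  ∈-insert : ∀ {x z} xs → z ∈ insert x xs ⇔ (z ≡ x ⊎ z ∈ xs)
  ∈-insert xs = mk⇔ (∈-insert⁻ xs) (∈-insert⁺ xs)

  ∷-insert-linked : ∀ {w x} xs → w < x → Linked _<_ (w ∷ xs) → Linked _<_ (w ∷ insert x xs)
  ∷-insert-linked [] w<x _ = w<x ∷ [-]
  ∷-insert-linked {x = x} (y ∷ ys) w<x (w<y ∷ y∷ys↑) with compare x y
  ... | tri< x<y _ _ = w<x ∷ x<y ∷ y∷ys↑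
  ... | tri≈ _ _ _ = w<y ∷ y∷ys↑
  ... | tri> _ _ y<x = w<y ∷ ∷-insert-linked ys y<x y∷ys↑

  insert-linked : ∀ {x} xs → Linked _<_ xs → Linked _<_ (insert x xs)
  insert-linked [] _ = [-]
  insert-linked {x} (y ∷ ys) y∷ys↑ with compare x y
  ... | tri< x<y _ _ = x<y ∷ y∷ys↑
  ... | tri≈ _ _ _ = y∷ys↑
  ... | tri> _ _ y<x = ∷-insert-linked ys y<x y∷ys↑

  sort : List A → List A
  sort = foldr insert []

  sort-linked : ∀ xs → Linked _<_ (sort xs)
  sort-linked [] = []
  sort-linked (x ∷ xs) = insert-linked (sort xs) (sort-linked xs)

  ∈-sort : ∀ {z} xs → z ∈ sort xs ⇔ z ∈ xs
  ∈-sort [] = mk⇔ id id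
  ∈-sort (x ∷ xs) = mk⇔
    (fromSum ∘ Sum.map₂ (to (∈-sort xs)) ∘ ∈-insert⁻ (sort xs))
    (∈-insert⁺ (sort xs) ∘ Sum.map₂ (from (∈-sort xs)) ∘ toSum)

  infix 4 _<lex_

  data _<lex_ : List A → List A → Set where
    this : ∀ {x y xs ys} → x < y → x ∷ xs <lex y ∷ ys
    next : ∀ {x xs ys} → xs <lex ys → x ∷ xs <lex x ∷ ys

  -- The form in which the lexicographic order enters the definition of _≼R_.
  CommonPrefixThen< : List A → List A → Set
  CommonPrefixThen< xs ys = ∃[ p ] ∃[ h ] ∃[ h' ] ∃[ t ] ∃[ t' ]
    (xs ≡ p ++ (h ∷ t) × ys ≡ p ++ (h' ∷ t') × h < h')

  <lex⇒CommonPrefixThen< : ∀ {xs ys} → xs <lex ys → CommonPrefixThen< xs ys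
  <lex⇒CommonPrefixThen< (this {x} {y} {xs} {ys} x<y) = [] , x , y , xs , ys , refl , refl , x<y
  <lex⇒CommonPrefixThen< (next {x} xs<ys) with <lex⇒CommonPrefixThen< xs<ys
  ... | p , h , h' , t , t' , refl , refl , h<h' = x ∷ p , h , h' , t , t' , refl , refl , h<h'

  CommonPrefixThen<⇒<lex : ∀ {xs ys} → CommonPrefixThen< xs ys → xs <lex ys
  CommonPrefixThen<⇒<lex ([] , _ , _ , _ , _ , refl , refl , h<h') = this h<h'
  CommonPrefixThen<⇒<lex (x ∷ p , h , h' , t , t' , refl , refl , h<h') =
    next (CommonPrefixThen<⇒<lex (p , h , h' , t , t' , refl , refl , h<h'))

  insert-below : ∀ {x y} ys → x < y → insert x (y ∷ ys) ≡ x ∷ y ∷ ys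
  insert-below {x} {y} _ x<y with compare x y
  ... | tri< _ _ _ = refl
  ... | tri≈ x≮y _ _ = ⊥-elim (x≮y x<y)
  ... | tri> x≮y _ _ = ⊥-elim (x≮y x<y)

  insert-above : ∀ {x y} ys → y < x → insert x (y ∷ ys) ≡ y ∷ insert x ys
  insert-above {x} {y} _ y<x with compare x y
  ... | tri< _ _ y≮x = ⊥-elim (y≮x y<x)
  ... | tri≈ _ _ y≮x = ⊥-elim (y≮x y<x)
  ... | tri> _ _ _ = refl

  -- The head of insert m (y ∷ ys) is m or y.
  ∷-<lex-insert : ∀ {x m y} xs ys → x < m → x < y → x ∷ xs <lex insert m (y ∷ ys)
  ∷-<lex-insert {m = m} {y} _ _ x<m x<y with compare m y
  ... | tri< _ _ _ = this x<m
  ... | tri≈ _ _ _ = this x<y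
  ... | tri> _ _ _ = this x<y

  ∷-<lex-insert≤ : ∀ {n m x y} xs ys → n < x → n < y → n ≤ m →
    x ∷ xs <lex y ∷ ys → n ∷ x ∷ xs <lex insert m (y ∷ ys)
  ∷-<lex-insert≤ {n} {m} {x} xs ys n<x n<y n≤m x∷xs<y∷ys with n ≟ₐ m
  ... | yes refl = subst (n ∷ x ∷ xs <lex_) (sym (insert-below ys n<y)) (next x∷xs<y∷ys)
  ... | no n≢m = ∷-<lex-insert (x ∷ xs) ys (n≤m , n≢m) n<y

  insert-<lex : ∀ {n m} xs → n ∉ xs → n < m → insert n xs <lex insert m xs
  insert-<lex [] _ n<m = this n<m
  insert-<lex {n} {m} (x ∷ xs) n∉ n<m with compare n x
  ... | tri≈ _ n≡x _ = ⊥-elim (n∉ (here n≡x))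
  ... | tri< n<x _ _ = ∷-<lex-insert (x ∷ xs) xs n<m n<x
  ... | tri> _ _ x<n = subst (x ∷ insert n xs <lex_) (sym (insert-above xs (<-trans x<n n<m)))
    (next (insert-<lex xs (n∉ ∘ there) n<m))

  insert-<lex-insert : ∀ {n m xs ys} → n ∉ xs → n ≤ m → xs <lex ys → insert n xs <lex insert m ys
  insert-<lex-insert {n} n∉ n≤m (this {h} {h'} {t} {t'} h<h') with compare n h
  ... | tri≈ _ n≡h _ = ⊥-elim (n∉ (here n≡h))
  ... | tri< n<h _ _ = ∷-<lex-insert≤ t t' n<h (<-trans n<h h<h') n≤m (this h<h')
  ... | tri> _ _ h<n = ∷-<lex-insert (insert n t) t' (<-≤-trans h<n n≤m) h<h'
  insert-<lex-insert {n} n∉ n≤m (next {x} {xs} {ys} xs<ys) with compare n x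
  ... | tri≈ _ n≡x _ = ⊥-elim (n∉ (here n≡x))
  ... | tri< n<x _ _ = ∷-<lex-insert≤ xs ys n<x n<x n≤m (next xs<ys)
  ... | tri> _ _ x<n = subst (x ∷ insert n xs <lex_) (sym (insert-above ys (<-≤-trans x<n n≤m)))
    (next (insert-<lex-insert (n∉ ∘ there) n≤m xs<ys))

lookup-≗⇒≡ : ∀ {A : Set} {k} {u v : Vec A k} → lookup u ≗ lookup v → u ≡ v
lookup-≗⇒≡ {u = u} {v} u≗v = begin
  u                   ≡⟨ tabulate∘lookup u ⟨
  tabulate (lookup u) ≡⟨ tabulate-cong u≗v ⟩
  tabulate (lookup v) ≡⟨ tabulate∘lookup v ⟩
  v                   ∎
  where open ≡-Reasoning

_≟ᵛ_ : ∀ {d} → DecidableEquality (ℕ^ d)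
_≟ᵛ_ = ≡-dec _≟_

module _ {d : ℕ} where

  ⊕-identityˡ : (x : ℕ^ d) → 𝟎 ⊕ x ≡ x
  ⊕-identityˡ = zipWith-identityˡ +-identityˡ

  ⊕-identityʳ : (x : ℕ^ d) → x ⊕ 𝟎 ≡ x
  ⊕-identityʳ = zipWith-identityʳ +-identityʳ

  lookup-act : ∀ (σ : Permutation′ d) x j → lookup (act σ x) j ≡ lookup x (σ ⟨$⟩ˡ j)
  lookup-act σ x = lookup∘tabulate _

  act-∘ₚ : ∀ (π ρ : Permutation′ d) x → act (π ∘ₚ ρ) x ≡ act ρ (act π x)
  act-∘ₚ π ρ x = tabulate-cong λ j → sym (lookup-act π x (ρ ⟨$⟩ˡ j))

  act-flip-act : ∀ (σ : Permutation′ d) x → act (flip σ) (act σ x) ≡ x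
  act-flip-act σ x = lookup-≗⇒≡ λ j →
    trans (lookup-act (flip σ) (act σ x) j) (trans (lookup-act σ x _) (cong (lookup x) (inverseˡ σ)))

  act-act-flip : ∀ (σ : Permutation′ d) x → act σ (act (flip σ) x) ≡ x
  act-act-flip σ x = lookup-≗⇒≡ λ j →
    trans (lookup-act σ (act (flip σ) x) j) (trans (lookup-act (flip σ) x _) (cong (lookup x) (inverseʳ σ)))

  act-injective : ∀ (σ : Permutation′ d) {x y} → act σ x ≡ act σ y → x ≡ y
  act-injective σ {x} {y} σx≡σy = begin
    x                      ≡⟨ act-flip-act σ x ⟨
    act (flip σ) (act σ x) ≡⟨ cong (act (flip σ)) σx≡σy ⟩
    act (flip σ) (act σ y) ≡⟨ act-flip-act σ y ⟩
    y                      ∎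
    where open ≡-Reasoning

  act-⊕ : ∀ (σ : Permutation′ d) a b → act σ (a ⊕ b) ≡ act σ a ⊕ act σ b
  act-⊕ σ a b = lookup-≗⇒≡ λ j → begin
    lookup (act σ (a ⊕ b)) j                   ≡⟨ lookup-act σ (a ⊕ b) j ⟩
    lookup (a ⊕ b) (σ ⟨$⟩ˡ j)                  ≡⟨ lookup-zipWith _+_ (σ ⟨$⟩ˡ j) a b ⟩
    lookup a (σ ⟨$⟩ˡ j) + lookup b (σ ⟨$⟩ˡ j)  ≡⟨ cong₂ _+_ (lookup-act σ a j) (lookup-act σ b j) ⟨
    lookup (act σ a) j + lookup (act σ b) j    ≡⟨ lookup-zipWith _+_ j (act σ a) (act σ b) ⟨
    lookup (act σ a ⊕ act σ b) j               ∎
    where open ≡-Reasoning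

  act-𝟎 : ∀ (σ : Permutation′ d) → act σ 𝟎 ≡ 𝟎
  act-𝟎 σ = lookup-≗⇒≡ λ j →
    trans (lookup-act σ 𝟎 j) (trans (lookup-replicate (σ ⟨$⟩ˡ j) 0) (sym (lookup-replicate j 0)))

  act-≢𝟎 : ∀ (σ : Permutation′ d) {x} → x ≢ 𝟎 → act σ x ≢ 𝟎
  act-≢𝟎 σ x≢𝟎 σx≡𝟎 = x≢𝟎 (act-injective σ (trans σx≡𝟎 (sym (act-𝟎 σ))))

  ≐-sym : {S S' : Subset d} → S ≐ S' → S' ≐ S
  ≐-sym S≐S' x = ⇔-sym (S≐S' x)

  ≐-trans : {S S' S'' : Subset d} → S ≐ S' → S' ≐ S'' → S ≐ S''
  ≐-trans S≐S' S'≐S'' x = ⇔-trans (S≐S' x) (S'≐S'' x)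

  ∖-cong : ∀ {S S' : Subset d} {y} → S ≐ S' → (S ∖[ y ]) ≐ (S' ∖[ y ])
  ∖-cong S≐S' x = mk⇔ (map₁ (to (S≐S' x))) (map₁ (from (S≐S' x)))

  actSet-∖ : ∀ (σ : Permutation′ d) S y → actSet σ (S ∖[ y ]) ≐ (actSet σ S ∖[ act σ y ])
  actSet-∖ σ S y x = mk⇔
    (λ { (z , (Sz , z≢y) , x≡σz) →
           (z , Sz , x≡σz) , λ x≡σy → z≢y (act-injective σ (trans (sym x≡σz) x≡σy)) })
    (λ { ((z , Sz , x≡σz) , x≢σy) →
           z , (Sz , λ z≡y → x≢σy (trans x≡σz (cong (act σ) z≡y))) , x≡σz })

  IsGapList : Subset d → List (ℕ^ d) → Set
  IsGapList S L = ∀ x → x ∈ L ⇔ (¬ S x)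

  IsGapList⇒∉ : ∀ {S L x} → IsGapList S L → S x → x ∉ L
  IsGapList⇒∉ {x = x} gaps Sx x∈L = to (gaps x) x∈L Sx

  IsGapList-cong : ∀ {S S' L} → S ≐ S' → IsGapList S L → IsGapList S' L
  IsGapList-cong S≐S' gaps x =
    mk⇔ (λ x∈L S'x → to (gaps x) x∈L (from (S≐S' x) S'x))
        (λ ¬S'x → from (gaps x) (¬S'x ∘ to (S≐S' x)))

  IsGapList-∖ : ∀ {S L K y} → IsGapList S L → (∀ x → x ∈ K ⇔ (x ≡ y ⊎ x ∈ L)) →
    IsGapList (S ∖[ y ]) K
  IsGapList-∖ {S} {L} {K} {y} gaps K≈y∷L x = mk⇔ gap⇒ ⇒gap
    where
    gap⇒ : x ∈ K → ¬ (S ∖[ y ]) x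
    gap⇒ x∈K (Sx , x≢y) = [ x≢y , (λ x∈L → to (gaps x) x∈L Sx) ] (to (K≈y∷L x) x∈K)
    ⇒gap : ¬ (S ∖[ y ]) x → x ∈ K
    ⇒gap x∉S∖y with x ≟ᵛ y
    ... | yes x≡y = from (K≈y∷L x) (inj₁ x≡y)
    ... | no x≢y = from (K≈y∷L x) (inj₂ (from (gaps x) λ Sx → x∉S∖y (Sx , x≢y)))

  IsGapList-act : ∀ (σ : Permutation′ d) {S L} → IsGapList S L → IsGapList (actSet σ S) (map (act σ) L)
  IsGapList-act σ {S} {L} gaps x = mk⇔ gap⇒ ⇒gap
    where
    gap⇒ : x ∈ map (act σ) L → ¬ actSet σ S x
    gap⇒ x∈σL (w , Sw , x≡σw) with ∈-map⁻ (act σ) x∈σL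
    ... | z , z∈L , x≡σz = to (gaps z) z∈L (subst S (act-injective σ (trans (sym x≡σw) x≡σz)) Sw)
    ⇒gap : ¬ actSet σ S x → x ∈ map (act σ) L
    ⇒gap x∉σS = subst (_∈ map (act σ) L) (act-act-flip σ x) (∈-map⁺ (act σ)
      (from (gaps (act (flip σ) x)) λ S-σ⁻¹x → x∉σS (act (flip σ) x , S-σ⁻¹x , sym (act-act-flip σ x))))

  IsMinimalGenerator-act⁻ : ∀ {T S : Subset d} σ {y} → T ≐ actSet σ S →
    IsMinimalGenerator T (act σ y) → IsMinimalGenerator S y
  IsMinimalGenerator-act⁻ {T} {S} σ {y} T≐σS (Tσy , σy≢𝟎 , σy-indecomposable) =
    Sy , (σy≢𝟎 ∘ y≡𝟎⇒σy≡𝟎) , λ { (a , b , Sa , a≢𝟎 , Sb , b≢𝟎 , y≡a⊕b) →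
      σy-indecomposable (act σ a , act σ b , σS⇒T Sa , act-≢𝟎 σ a≢𝟎 , σS⇒T Sb , act-≢𝟎 σ b≢𝟎 ,
                          trans (cong (act σ) y≡a⊕b) (act-⊕ σ a b)) }
    where
    Sy : S y
    Sy with to (T≐σS (act σ y)) Tσy
    ... | z , Sz , σy≡σz = subst S (sym (act-injective σ σy≡σz)) Sz
    y≡𝟎⇒σy≡𝟎 : y ≡ 𝟎 → act σ y ≡ 𝟎
    y≡𝟎⇒σy≡𝟎 y≡𝟎 = trans (cong (act σ) y≡𝟎) (act-𝟎 σ)
    σS⇒T : ∀ {a} → S a → T (act σ a)
    σS⇒T {a} Sa = from (T≐σS (act σ a)) (a , Sa , refl)

  minimalGenerator-⊕-≢ : ∀ {S : Subset d} {y a b} → IsMinimalGenerator S y →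
    S a → S b → a ≢ y → b ≢ y → a ⊕ b ≢ y
  minimalGenerator-⊕-≢ {a = a} {b} (_ , _ , y-indecomposable) Sa Sb a≢y b≢y a⊕b≡y
    with a ≟ᵛ 𝟎 | b ≟ᵛ 𝟎
  ... | yes refl | _ = b≢y (trans (sym (⊕-identityˡ b)) a⊕b≡y)
  ... | no _ | yes refl = a≢y (trans (sym (⊕-identityʳ a)) a⊕b≡y)
  ... | no a≢𝟎 | no b≢𝟎 = y-indecomposable (a , b , Sa , a≢𝟎 , Sb , b≢𝟎 , sym a⊕b≡y)

  IsGNS-∖ : ∀ {g} {S : Subset d} {y} → IsGNS g S → IsMinimalGenerator S y → IsGNS (suc g) (S ∖[ y ])
  IsGNS-∖ {S = S} {y} S-gns y-min@(Sy , y≢𝟎 , _) = record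
    { zero∈ = zero∈ , y≢𝟎 ∘ sym
    ; closed = λ { a b (Sa , a≢y) (Sb , b≢y) →
        closed a b Sa Sb , minimalGenerator-⊕-≢ y-min Sa Sb a≢y b≢y }
    ; gaps = y ∷ gaps
    ; gaps-unique = ¬Any⇒All¬ gaps (IsGapList⇒∉ gaps-spec Sy) ∷ gaps-unique
    ; gaps-spec = IsGapList-∖ gaps-spec λ _ → mk⇔ toSum fromSum
    ; genus = cong suc genus
    }
    where open IsGNS S-gns

module _ {d : ℕ} {_≼_ : ℕ^ d → ℕ^ d → Set} (isTotalOrder : IsTotalOrder _≡_ _≼_) where

  open StrictInsertion _≟ᵛ_ isTotalOrder

  SortedGaps-cong : ∀ {S S' L} → S ≐ S' → SortedGaps _≼_ S L → SortedGaps _≼_ S' L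
  SortedGaps-cong S≐S' (L↑ , gaps) = L↑ , IsGapList-cong S≐S' gaps

  SortedGaps-∖ : ∀ {S L y} → SortedGaps _≼_ S L → SortedGaps _≼_ (S ∖[ y ]) (insert y L)
  SortedGaps-∖ {L = L} (L↑ , gaps) = insert-linked L L↑ , IsGapList-∖ gaps λ _ → ∈-insert L

  IsGapList⇒SortedGaps : ∀ {S L} → IsGapList S L → SortedGaps _≼_ S (sort L)
  IsGapList⇒SortedGaps {L = L} gaps =
    sort-linked L , λ x → ⇔-trans (∈-sort L) (gaps x)

  ≼R-respʳ-≐ : ∀ {S S' S''} → S' ≐ S'' → _≼R_ _≼_ S S' → _≼R_ _≼_ S S''
  ≼R-respʳ-≐ S'≐S'' (inj₁ S≐S') = inj₁ (≐-trans S≐S' S'≐S'')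
  ≼R-respʳ-≐ S'≐S'' (inj₂ (L , L' , sorted , sorted' , L<L')) =
    inj₂ (L , L' , sorted , SortedGaps-cong S'≐S'' sorted' , L<L')

  ≼R-∖ : ∀ {S S' L n m} → IsGapList S L → S n → n ≼ m →
    _≼R_ _≼_ S S' → _≼R_ _≼_ (S ∖[ n ]) (S' ∖[ m ])
  ≼R-∖ {L = L} {n} {m} gaps Sn n≼m (inj₁ S≐S') with n ≟ᵛ m
  ... | yes refl = inj₁ (∖-cong S≐S')
  ... | no n≢m = inj₂ (insert n (sort L) , insert m (sort L) ,
      SortedGaps-∖ sorted , SortedGaps-∖ (SortedGaps-cong S≐S' sorted) ,
      <lex⇒CommonPrefixThen< (insert-<lex (sort L) (IsGapList⇒∉ (proj₂ sorted) Sn) (n≼m , n≢m)))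
    where sorted = IsGapList⇒SortedGaps gaps
  ≼R-∖ {n = n} {m} _ Sn n≼m (inj₂ (L , L' , sorted , sorted' , L<L')) =
    inj₂ (insert n L , insert m L' , SortedGaps-∖ sorted , SortedGaps-∖ sorted' ,
      <lex⇒CommonPrefixThen<
        (insert-<lex-insert (IsGapList⇒∉ (proj₂ sorted) Sn) n≼m (CommonPrefixThen<⇒<lex L<L')))

mainTheorem9 : (g d : ℕ) → 1 ≤ g → 1 ≤ d →
    (_≼_ : ℕ^ d → ℕ^ d → Set) → IsRelaxedMonomialOrder _≼_ →
    (T : Subset d) → InR _≼_ (g ∸ 1) T →
    (n : ℕ^ d) → IsMinimalGenerator T n →
    (∀ (σ : Permutation′ d) → n ≼ act σ n) →
    InR _≼_ g (T ∖[ n ])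
mainTheorem9 (suc g) d _ _ _≼_ ≼-relaxed T (S , S-gns , (σ , T≐σS) , T-least) n n-min n-least
  with to (T≐σS n) (proj₁ n-min)
... | y , _ , refl =
  S ∖[ y ] , IsGNS-∖ S-gns (IsMinimalGenerator-act⁻ σ T≐σS n-min) ,
  (σ , ≐-trans (∖-cong T≐σS) (≐-sym (actSet-∖ σ S y))) ,
  λ τ → ≼R-respʳ-≐ isTotalOrder (≐-sym (actSet-∖ τ S y))
          (≼R-∖ isTotalOrder T-gaps (proj₁ n-min) (n≼τy τ) (T-least τ))
  where
  open IsRelaxedMonomialOrder ≼-relaxed using (isTotalOrder)
  T-gaps : IsGapList T (map (act σ) (IsGNS.gaps S-gns))
  T-gaps = IsGapList-cong (≐-sym T≐σS) (IsGapList-act σ (IsGNS.gaps-spec S-gns))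
  n≼τy : ∀ τ → act σ y ≼ act τ y
  n≼τy τ = subst (act σ y ≼_) (trans (act-∘ₚ (flip σ) τ (act σ y)) (cong (act τ) (act-flip-act σ y)))
    (n-least (flip σ ∘ₚ τ))
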